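{- $\mathcal{L}_{FH}\prec\mathcal{L}_{AIL}$; that is, (i) for every $\varphi_1\in\mathcal{L}_{FH}$ there is $\varphi_2\in\mathcal{L}_{AIL}$ such that for every epistemic model with awareness $M$ and every world $w$ of $M$, $M,w\vDash_{FH}\varphi_1$ iff $M,w\vDash_{AIL}\varphi_2$; and (ii) it is not the case that for every $\psi_1\in\mathcal{L}_{AIL}$ there is $\psi_2\in\mathcal{L}_{FH}$ with $M,w\vDash_{AIL}\psi_1$ iff $M,w\vDash_{FH}\psi_2$ for all $M,w$.
   Context: Let $\mathcal{P}$ be a countable set of atomic propositions and $\mathcal{G}$ a finite set of agents. The language $\mathcal{L}_{AIL}$ is generated by $\varphi::= p\mid\neg\varphi\mid\varphi\wedge\varphi\mid A_i\varphi\mid I_i\varphi\mid E_i\varphi\mid[\approx]_i\varphi\mid[\circ^+]_i\varphi$ ($p\in\mathcal{P}$, $i\in\mathcal{G}$); $\mathcal{L}_{FH}$ is the sublanguage generated by $\varphi::= p\mid\neg\varphi\mid\varphi\wedge\varphi\mid A_i\varphi\mid I_i\varphi\mid E_i\varphi$. $At(\varphi)$ is the set of atomic propositions occurring in $\varphi$. An epistemic model with awareness is $M=\langle W,\{\sim_i,\mathscr{A}_i\}_{i\in\mathcal{G}},V\rangle$ where $W\neq\emptyset$, each $\sim_i$ is an equivalence relation on $W$, each $\mathscr{A}_i:W\to 2^{\mathcal{P}}$ satisfies: if $(w,v)\in\sim_i$ then $\mathscr{A}_i(w)=\mathscr{A}_i(v)$, and $V:\mathcal{P}\to 2^W$. The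 A-equivalence relation $\approx_i$ on $W$: $(w,v)\in\approx_i$ iff $\mathscr{A}_i(w)=\mathscr{A}_i(v)$ and for every $p\in\mathscr{A}_i(w)$, $w\in V(p)$ iff $v\in V(p)$. Let $\sim_i\circ\approx_i=\{(w,u)\mid \exists t\,((w,t)\in\approx_i\text{ and }(t,u)\in\sim_i)\}$ and let $(\sim_i\circ\approx_i)^+$ be its transitive closure. Semantics $\vDash_{AIL}$: $M,w\vDash p$ iff $w\in V(p)$; Boolean clauses as usual; $M,w\vDash A_i\varphi$ iff $At(\varphi)\subseteq\mathscr{A}_i(w)$; $M,w\vDash I_i\varphi$ iff $M,v\vDash\varphi$ for all $v$ with $(w,v)\in\sim_i$; $M,w\vDash[\approx]_i\varphi$ iff $M,v\vDash\varphi$ for all $v$ with $(w,v)\in\approx_i$; $M,w\vDash[\circ^+]_i\varphi$ iff $M,v\vDash\varphi$ for all $v$ with $(w,v)\in(\sim_i\circ\approx_i)^+$; $M,w\vDash E_i\varphi$ iff $M,w\vDash A_i\varphi$ and $M,w\vDash[\circ^+]_i\varphi$. Semantics $\vDash_{FH}$ on the same models for $\mathcal{L}_{FH}$: same clauses for atoms, Booleans, $A_i$, $I_i$, but $M,w\vDash_{FH}E_i\varphi$ iff $M,w\vDash_{FH}A_i\varphi$ and $M,w\vDash_{FH}I_i\varphi$. $\mathcal{L}_1\preceq\mathcal{L}_2$ means every formula of $\mathcal{L}_1$ is equivalent (true at exactly the same pointed models, each under its own semantics) to some formula of $\mathcal{L}_2$; $\mathcal{L}_1\prec\mathcal{L}_2$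 means $\mathcal{L}_1\preceq\mathcal{L}_2$ and $\mathcal{L}_2\not\preceq\mathcal{L}_1$. -}

module Defs where

open import Data.Nat using (ℕ)
open import Data.Fin using (Fin)
open import Data.List using (List; []; _++_; [_])
open import Data.List.Membership.Propositional using (_∈_)
open import Data.Product using (_×_; Σ; ∃)
open import Relation.Nullary using (¬_)
open import Relation.Binary using (IsEquivalence)
open import Relation.Binary.Construct.Closure.Transitive using (TransClosure)
open import Function.Bundles using (_⇔_)

Prop : Set
Prop = ℕ

PSet : Set₁
PSet = Prop → Set

_≐_ : PSet → PSet → Set
X ≐ Y = ∀ p → X p ⇔ Y p

data Form (k : ℕ) : Set where
  atom  : Prop → Form k
  ¬'_   : Form k → Form k
  _∧'_  : Form k → Form k → Form k
  A     : Fin k → Form k → Form k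
  I     : Fin k → Form k → Form k
  E     : Fin k → Form k → Form k
  [≈]   : Fin k → Form k → Form k
  [∘⁺]  : Fin k → Form k → Form k

data FormFH (k : ℕ) : Set where
  atom  : Prop → FormFH k
  ¬'_   : FormFH k → FormFH k
  _∧'_  : FormFH k → FormFH k → FormFH k
  A     : Fin k → FormFH k → FormFH k
  I     : Fin k → FormFH k → FormFH k
  E     : Fin k → FormFH k → FormFH k

At : ∀ {k} → Form k → List Prop
At (atom p)   = [ p ]
At (¬' φ)     = At φ
At (φ ∧' ψ)   = At φ ++ At ψ
At (A i φ)    = At φ
At (I i φ)    = At φ
At (E i φ)    = At φ
At ([≈] i φ)  = At φ
At ([∘⁺] i φ) = At φ

AtFH : ∀ {k} → FormFH k → List Prop
AtFH (atom p) = [ p ]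
AtFH (¬' φ)   = AtFH φ
AtFH (φ ∧' ψ) = AtFH φ ++ AtFH ψ
AtFH (A i φ)  = AtFH φ
AtFH (I i φ)  = AtFH φ
AtFH (E i φ)  = AtFH φ

record Model (k : ℕ) : Set₁ where
  field
    W       : Set
    w₀      : W                                   -- W ≠ ∅
    ∼       : Fin k → W → W → Set
    ∼-equiv : ∀ i → IsEquivalence (∼ i)
    𝒜       : Fin k → W → PSet
    𝒜-∼     : ∀ i w v → ∼ i w v → 𝒜 i w ≐ 𝒜 i v
    V       : Prop → W → Set

  ≈ : Fin k → W → W → Set
  ≈ i w v = (𝒜 i w ≐ 𝒜 i v) × (∀ p → 𝒜 i w p → (V p w ⇔ V p v))

  ∘ : Fin k → W → W → Set
  ∘ i w u = ∃ λ t → ≈ i w t × ∼ i t u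

  ∘⁺ : Fin k → W → W → Set
  ∘⁺ i = TransClosure (∘ i)

open Model public

_,_⊨_ : ∀ {k} (M : Model k) → W M → Form k → Set
M , w ⊨ atom p     = V M p w
M , w ⊨ (¬' φ)     = ¬ (M , w ⊨ φ)
M , w ⊨ (φ ∧' ψ)   = (M , w ⊨ φ) × (M , w ⊨ ψ)
M , w ⊨ A i φ      = ∀ p → p ∈ At φ → 𝒜 M i w p
M , w ⊨ I i φ      = ∀ v → ∼ M i w v → M , v ⊨ φ
M , w ⊨ E i φ      = (∀ p → p ∈ At φ → 𝒜 M i w p) × (∀ v → ∘⁺ M i w v → M , v ⊨ φ)
M , w ⊨ [≈] i φ    = ∀ v → ≈ M i w v → M , v ⊨ φ
M , w ⊨ [∘⁺] i φ   = ∀ v → ∘⁺ M i w v → M , v ⊨ φ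

_,_⊨FH_ : ∀ {k} (M : Model k) → W M → FormFH k → Set
M , w ⊨FH atom p   = V M p w
M , w ⊨FH (¬' φ)   = ¬ (M , w ⊨FH φ)
M , w ⊨FH (φ ∧' ψ) = (M , w ⊨FH φ) × (M , w ⊨FH ψ)
M , w ⊨FH A i φ    = ∀ p → p ∈ AtFH φ → 𝒜 M i w p
M , w ⊨FH I i φ    = ∀ v → ∼ M i w v → M , v ⊨FH φ
M , w ⊨FH E i φ    = (∀ p → p ∈ AtFH φ → 𝒜 M i w p) × (∀ v → ∼ M i w v → M , v ⊨FH φ)

FH⪯AIL : ℕ → Set₁
FH⪯AIL k = ∀ (φ₁ : FormFH k) → Σ (Form k) λ φ₂ →
  ∀ (M : Model k) (w : W M) → (M , w ⊨FH φ₁) ⇔ (M , w ⊨ φ₂)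

AIL⪯FH : ℕ → Set₁
AIL⪯FH k = ∀ (ψ₁ : Form k) → Σ (FormFH k) λ ψ₂ →
  ∀ (M : Model k) (w : W M) → (M , w ⊨ ψ₁) ⇔ (M , w ⊨FH ψ₂)

{-# OPTIONS --safe #-}
-- The FH operator E_i φ is A_i φ ∧ I_i φ, so L_FH translates into L_AIL.
-- Conversely, FH truth is invariant under bisimulations respecting valuation,
-- awareness and the ∼_i, while [≈]_i quantifies over the worlds the agent cannot
-- tell apart by the atoms she is aware of. With identity ∼_i and empty awareness,
-- a one-world model satisfying p is bisimilar to the p-world of a two-world model;
-- [≈]_i p holds in the first but fails in the second, where ≈_i relates both worlds.
module Submission where

open import Defs
open import Data.Nat using (ℕ; suc)
open import Data.Bool using (Bool; true; false)
open import Data.Empty using (⊥; ⊥-elim)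
open import Data.Fin using (zero)
open import Data.List using (List)
open import Data.List.Membership.Propositional using (_∈_)
open import Data.List.Relation.Binary.BagAndSetEquality using (_∼[_]_; set; ++-cong; ++-idempotent)
open import Data.Product using (_×_; _,_; ∃)
open import Data.Product.Function.NonDependent.Propositional using (_×-⇔_)
open import Data.Unit using (⊤; tt)
open import Function.Bundles using (_⇔_; mk⇔; Equivalence)
open import Function.Related.TypeIsomorphisms using (¬-cong-⇔)
import Function.Properties.Equivalence as ⇔
open import Relation.Binary.PropositionalEquality using (_≡_; refl; isEquivalence)
open import Relation.Nullary using (¬_)

open Equivalence

∀→-cong : {W : Set} {R P Q : W → Set} →
          (∀ v → P v ⇔ Q v) → (∀ v → R v → P v) ⇔ (∀ v → R v → Q v)
∀→-cong P⇔Q = mk⇔ (λ h v r → to (P⇔Q v) (h v r)) (λ h v r → from (P⇔Q v) (h v r))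

∀∈-cong : {A : Set} {X : A → Set} {xs ys : List A} →
          xs ∼[ set ] ys → (∀ p → p ∈ xs → X p) ⇔ (∀ p → p ∈ ys → X p)
∀∈-cong xs≈ys = mk⇔ (λ h p p∈ys → h p (from xs≈ys p∈ys)) (λ h p p∈xs → h p (to xs≈ys p∈xs))

module _ {k : ℕ} where

  embed : FormFH k → Form k
  embed (atom p) = atom p
  embed (¬' φ)   = ¬' embed φ
  embed (φ ∧' ψ) = embed φ ∧' embed ψ
  embed (A i φ)  = A i (embed φ)
  embed (I i φ)  = I i (embed φ)
  embed (E i φ)  = A i (embed φ) ∧' I i (embed φ)

  At-embed : ∀ φ → At (embed φ) ∼[ set ] AtFH φ
  At-embed (atom p) = ⇔.refl
  At-embed (¬' φ)   = At-embed φ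
  At-embed (φ ∧' ψ) = ++-cong (At-embed φ) (At-embed ψ)
  At-embed (A i φ)  = At-embed φ
  At-embed (I i φ)  = At-embed φ
  At-embed (E i φ)  = ⇔.trans (++-idempotent (At (embed φ))) (At-embed φ)

  ⊨FH⇔⊨-embed : ∀ (M : Model k) φ w → (M , w ⊨FH φ) ⇔ (M , w ⊨ embed φ)
  ⊨FH⇔⊨-embed M (atom p) w = ⇔.refl
  ⊨FH⇔⊨-embed M (¬' φ)   w = ¬-cong-⇔ (⊨FH⇔⊨-embed M φ w)
  ⊨FH⇔⊨-embed M (φ ∧' ψ) w = ⊨FH⇔⊨-embed M φ w ×-⇔ ⊨FH⇔⊨-embed M ψ w
  ⊨FH⇔⊨-embed M (A i φ)  w = ∀∈-cong (⇔.sym (At-embed φ))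
  ⊨FH⇔⊨-embed M (I i φ)  w = ∀→-cong (λ v → ⊨FH⇔⊨-embed M φ v)
  ⊨FH⇔⊨-embed M (E i φ)  w =
    ∀∈-cong (⇔.sym (At-embed φ)) ×-⇔ ∀→-cong (λ v → ⊨FH⇔⊨-embed M φ v)

  FH⪯AIL-embed : FH⪯AIL k
  FH⪯AIL-embed φ = embed φ , λ M w → ⊨FH⇔⊨-embed M φ w

  unaware-≈ : ∀ (M : Model k) {i w v} →
    (∀ p → ¬ 𝒜 M i w p) → (∀ p → ¬ 𝒜 M i v p) → ≈ M i w v
  unaware-≈ M unaware-w unaware-v =
    (λ p → mk⇔ (λ a → ⊥-elim (unaware-w p a)) (λ a → ⊥-elim (unaware-v p a))) ,
    (λ p a → ⊥-elim (unaware-w p a))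

  record FHBisimulation (M N : Model k) : Set₁ where
    field
      R         : W M → W N → Set
      atoms     : ∀ {w w'} → R w w' → ∀ p → V M p w ⇔ V N p w'
      awareness : ∀ {w w'} → R w w' → ∀ i → 𝒜 M i w ≐ 𝒜 N i w'
      forth     : ∀ {w w' v} i → R w w' → ∼ M i w v → ∃ λ v' → ∼ N i w' v' × R v v'
      back      : ∀ {w w' v'} i → R w w' → ∼ N i w' v' → ∃ λ v → ∼ M i w v × R v v'

  module _ {M N : Model k} (B : FHBisimulation M N) where
    open FHBisimulation B

    ∼-box-invariant : ∀ {P : W M → Set} {Q : W N → Set} i {w w'} →
      (∀ {v v'} → R v v' → P v ⇔ Q v') → R w w' →
      (∀ v → ∼ M i w v → P v) ⇔ (∀ v' → ∼ N i w' v' → Q v')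
    ∼-box-invariant i P⇔Q r = mk⇔
      (λ h v' w'∼v' → let (v , w∼v , rv) = back i r w'∼v' in to (P⇔Q rv) (h v w∼v))
      (λ h v w∼v → let (v' , w'∼v' , rv) = forth i r w∼v in from (P⇔Q rv) (h v' w'∼v'))

    ⊨FH-bisimulation-invariant : ∀ φ {w w'} → R w w' → (M , w ⊨FH φ) ⇔ (N , w' ⊨FH φ)
    ⊨FH-bisimulation-invariant (atom p) r = atoms r p
    ⊨FH-bisimulation-invariant (¬' φ)   r = ¬-cong-⇔ (⊨FH-bisimulation-invariant φ r)
    ⊨FH-bisimulation-invariant (φ ∧' ψ) r =
      ⊨FH-bisimulation-invariant φ r ×-⇔ ⊨FH-bisimulation-invariant ψ r
    ⊨FH-bisimulation-invariant (A i φ)  r = ∀→-cong (awareness r i)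
    ⊨FH-bisimulation-invariant (I i φ)  r = ∼-box-invariant i (⊨FH-bisimulation-invariant φ) r
    ⊨FH-bisimulation-invariant (E i φ)  r =
      ∀→-cong (awareness r i) ×-⇔ ∼-box-invariant i (⊨FH-bisimulation-invariant φ) r

  discreteUnaware : (W : Set) → W → (Prop → W → Set) → Model k
  discreteUnaware W w₀ V = record
    { W = W ; w₀ = w₀ ; ∼ = λ _ → _≡_ ; ∼-equiv = λ _ → isEquivalence
    ; 𝒜 = λ _ _ _ → ⊥ ; 𝒜-∼ = λ _ _ _ _ _ → ⇔.refl ; V = V }

  discreteUnaware-bisimulation : ∀ {W W' w₀ w₀' V V'} →
    FHBisimulation (discreteUnaware W w₀ V) (discreteUnaware W' w₀' V')
  discreteUnaware-bisimulation {V = V} {V'} = record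
    { R         = λ w w' → ∀ p → V p w ⇔ V' p w'
    ; atoms     = λ r → r
    ; awareness = λ _ _ _ → ⇔.refl
    ; forth     = λ { {w' = w'} _ r refl → w' , refl , r }
    ; back      = λ { {w = w} _ r refl → w , refl , r } }

[≈]-not-FH-definable : ∀ n → ¬ AIL⪯FH (suc n)
[≈]-not-FH-definable n AIL⪯FH with AIL⪯FH ([≈] zero (atom 0))
... | ψ , [≈]p⇔ψ = false≢true (two⊨[≈]p false true≈false)
  where
    one two : Model (suc n)
    one = discreteUnaware ⊤ tt (λ _ _ → ⊤)
    two = discreteUnaware Bool true (λ _ b → b ≡ true)

    one⊨[≈]p : one , tt ⊨ [≈] zero (atom 0)
    one⊨[≈]p _ _ = tt

    tt-and-true-agree : ∀ p → ⊤ ⇔ (true ≡ true)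
    tt-and-true-agree _ = mk⇔ (λ _ → refl) (λ _ → tt)

    two⊨ψ : two , true ⊨FH ψ
    two⊨ψ = to (⊨FH-bisimulation-invariant discreteUnaware-bisimulation ψ tt-and-true-agree)
               (to ([≈]p⇔ψ one tt) one⊨[≈]p)

    two⊨[≈]p : two , true ⊨ [≈] zero (atom 0)
    two⊨[≈]p = from ([≈]p⇔ψ two true) two⊨ψ

    true≈false : ≈ two zero true false
    true≈false = unaware-≈ two {zero} {true} {false} (λ _ ()) (λ _ ())

    false≢true : ¬ (false ≡ true)
    false≢true ()

theorem1 : ∀ (n : ℕ) → FH⪯AIL (suc n) × ¬ AIL⪯FH (suc n)
theorem1 n = FH⪯AIL-embed , [≈]-not-FH-definable n
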